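{- Let $n\ge 3$ and $1\le k\le n$. Every edge of the enhanced hypercube $Q_{n,k}$ lies on a cycle of every even length from $4$ to $2^n$. Moreover, if $k$ is even, every edge of $Q_{n,k}$ lies on a cycle of every odd length from $k+3$ to $2^n-1$, and every edge not in $E_i$ for any $i$ with $k+1\le i\le n$ also lies on an odd cycle of length $k+1$.
   Context: The hypercube $Q_n$ has vertex set all binary strings $u_nu_{n-1}\cdots u_1$, with two vertices adjacent iff they differ in exactly one bit; an edge joining vertices differing in the $i$-th bit is an $i$-dimensional hypercube edge, and $E_i$ denotes the set of $i$-dimensional hypercube edges. For $1\le k\le n$, the enhanced hypercube $Q_{n,k}$ is obtained from $Q_n$ by adding, for every vertex $u=u_n\cdots u_1$, an edge (a skip) between $u$ and $u_n\cdots u_{k+1}\bar u_k\bar u_{k-1}\cdots\bar u_1$, where $\bar u_i=1-u_i$. Skips are not in any $E_i$. -}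

module Defs where

open import Data.Bool using (Bool; not; if_then_else_)
open import Data.Nat using (ℕ; suc; _+_; _<ᵇ_)
open import Data.Fin using (Fin; toℕ)
open import Data.Vec using (Vec; updateAt; lookup; tabulate)
open import Data.List using (List; _∷_; []; _++_; [_]; length)
open import Data.List.Relation.Unary.Linked using (Linked)
open import Data.List.Relation.Unary.Unique.Propositional using (Unique)
open import Data.Product using (Σ; ∃; _×_)
open import Data.Sum using (_⊎_)
open import Relation.Binary.PropositionalEquality using (_≡_)

-- A vertex u_n ... u_1 of Q_n is a vector of n bits; position j : Fin n
-- holds bit u_{toℕ j + 1}.
Vertex : ℕ → Set
Vertex n = Vec Bool n

flipBit : ∀ {n} → Fin n → Vertex n → Vertex n
flipBit i u = updateAt u i not

skip : ∀ {n} → ℕ → Vertex n → Vertex n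
skip k u = tabulate (λ j → if toℕ j <ᵇ k then not (lookup u j) else lookup u j)

-- u v is an edge of dimension (toℕ i + 1), i.e. in E_{toℕ i + 1}.
HEdge : ∀ {n} → Fin n → Vertex n → Vertex n → Set
HEdge i u v = v ≡ flipBit i u

Adj : (n k : ℕ) → Vertex n → Vertex n → Set
Adj n k u v = (∃ λ (i : Fin n) → HEdge i u v) ⊎ (v ≡ skip k u)

OnCycle : (n k ℓ : ℕ) → Vertex n → Vertex n → Set
OnCycle n k ℓ u v =
  Σ (List (Vertex n)) λ rest →
    (length (u ∷ v ∷ rest) ≡ ℓ)
    × Unique (u ∷ v ∷ rest)
    × Linked (Adj n k) (u ∷ v ∷ rest ++ [ u ])

module Submission where

-- A cycle of length ℓ through the edge uv is the same as a path from v back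
-- to u with ℓ vertices (lemma close).  All such paths are assembled from
-- paths inside the two copies of Q_m in Q_{m+1} obtained by fixing one bit,
-- glued along a single edge between the copies (bridge).  The engine is the
-- bipanconnectivity of the ordinary hypercube (bipanconnected): vertices of
-- Q_m at Hamming distance d ≥ 1 are joined by paths with every number
-- d + 1 + 2j ≤ 2^m of vertices, by induction on m.  Then, in Q_{n,k}:
--   * even ℓ: a hypercube edge is handled by bipanconnectivity directly, a
--     skip by two even paths joined by a second skip (even-skip-paths);
--   * odd ℓ, k even: since a skip complements k bits, crossing between the
--     copies next to a skip yields paths of the opposite parity (odd-across);
--     this covers skips and edges of dimension ≤ k for all odd ℓ ≥ k + 1,
--     and edges of dimension > k for ℓ ≥ k + 3 (odd-high-paths).

open import Defs
open import Data.Bool using (Bool; true; false; not)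
open import Data.Bool.Properties using (not-involutive; not-¬)
open import Data.Nat using (ℕ; zero; suc; _+_; _*_; _∸_; _^_; _≤_; _<_; z≤n; s≤s; s≤s⁻¹; _≤?_)
open import Data.Nat.Properties
  using (+-identityʳ; +-comm; ≤-refl; ≤-reflexive; ≤-trans; <⇒≤; n≤1+n; m≤n⇒m≤1+n; suc-injective; m<m+n; m^n>0;
         *-monoʳ-≤; +-cancelʳ-≤; m+n≤o⇒n≤o; m∸n≤m; ≮⇒≥; ≰⇒>; m≤n⇒∃[o]m+o≡n; module ≤-Reasoning)
open import Data.Nat.Divisibility using (_∣_; divides; ∣m∣n⇒∣m+n; m∣m*n; ∣⇒≤)
open import Data.Nat.Tactic.RingSolver using (solve-∀)
open import Data.Fin using (Fin; toℕ; punchIn) renaming (zero to fzero; suc to fsuc)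
open import Data.Fin.Properties using (toℕ<n)
open import Data.Vec using ([]; _∷_; insertAt; removeAt; lookup)
open import Data.Vec.Properties using (removeAt-insertAt; insertAt-removeAt; insertAt-lookup)
open import Data.List using (List; []; _∷_; _++_; [_]; length; map)
open import Data.List.Properties using (length-++; length-map)
open import Data.List.Relation.Unary.Linked using (Linked; [-]; _∷_)
open import Data.List.Relation.Unary.All using ([])
open import Data.List.Relation.Unary.Unique.Propositional using (Unique; []; _∷_)
import Data.List.Relation.Unary.Unique.Propositional.Properties as Unique
import Data.List.Relation.Binary.Permutation.Setoid as Permutation
import Data.List.Relation.Binary.Permutation.Setoid.Properties as PermutationProperties
open import Data.List.Relation.Binary.Disjoint.Propositional using (Disjoint)
open import Data.List.Relation.Unary.Any using (here)
open import Data.List.Membership.Propositional using (_∈_; _∉_)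
open import Data.List.Membership.Propositional.Properties using (∈-map⁻; ∈-++⁻)
open import Data.Product using (Σ; ∃; ∃-syntax; _×_; _,_; proj₁; proj₂)
open import Data.Sum using (_⊎_; inj₁; inj₂)
open import Data.Empty using (⊥-elim)
open import Function.Definitions using (Injective)
open import Relation.Nullary using (yes; no; ¬_)
open import Relation.Binary.PropositionalEquality
  using (_≡_; _≢_; refl; sym; trans; cong; cong₂; subst; subst₂; setoid; module ≡-Reasoning)

data Walk {A : Set} (R : A → A → Set) : A → A → List A → Set where
  stop : ∀ {x} → Walk R x x [ x ]
  step : ∀ {x y z vs} → R x y → Walk R y z vs → Walk R x z (x ∷ vs)

record Path {A : Set} (R : A → A → Set) (x y : A) (L : ℕ) : Set where
  constructor path
  field
    vertices : List A
    walk     : Walk R x y vertices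
    unique   : Unique vertices
    size     : length vertices ≡ L

open Path

module _ {A : Set} {R : A → A → Set} where

  walk-++ : ∀ {x y z w vs ws} → Walk R x y vs → R y z → Walk R z w ws → Walk R x w (vs ++ ws)
  walk-++ stop e W = step e W
  walk-++ (step e′ V) e W = step e′ (walk-++ V e W)

  walk-linked : ∀ {x y vs} → Walk R x y vs → Linked R vs
  walk-linked stop = [-]
  walk-linked (step e stop) = e ∷ [-]
  walk-linked (step e W@(step _ _)) = e ∷ walk-linked W

  walk-last : ∀ {x y vs} → Walk R x y vs → ∃[ pre ] vs ≡ pre ++ [ y ]
  walk-last stop = [] , refl
  walk-last {x} (step _ W) = let pre , eq = walk-last W in x ∷ pre , cong (x ∷_) eq

  single : ∀ {x} → Path R x x 1
  single {x} = path [ x ] stop ([] ∷ []) refl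

  join : ∀ {x y z w L₁ L₂} (P : Path R x y L₁) → R y z → (Q : Path R z w L₂) →
    Disjoint (vertices P) (vertices Q) → Path R x w (L₁ + L₂)
  join (path vs V uV |vs|) e (path ws W uW |ws|) disjoint =
    path (vs ++ ws) (walk-++ V e W) (Unique.++⁺ uV uW disjoint) (trans (length-++ vs) (cong₂ _+_ |vs| |ws|))

  prepend : ∀ {w x y L} → R w x → (P : Path R x y L) → w ∉ vertices P → Path R w y (suc L)
  prepend e P w∉P = join single e P λ { (here refl , w∈P) → w∉P w∈P }

  uncons : ∀ {x y L} → Path R x y (suc (suc L)) →
    ∃[ x′ ] R x x′ × Σ (Path R x′ y (suc L)) λ P → x ∉ vertices P
  uncons (path (_ ∷ vs) (step {y = x′} e W) (x∉vs ∷ uvs) size) =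
    x′ , e , path vs W uvs (suc-injective size) , Unique.Unique[x∷xs]⇒x∉xs (x∉vs ∷ uvs)

  -- A path whose end is adjacent to its start closes up into a cycle: the
  -- vertex list u ∷ v ∷ rest is a rotation of the path's list v ∷ rest ++ [ u ].
  close : ∀ {u v L} → R u v → Path R v u L → 2 ≤ L →
    Σ (List A) λ rest → length (u ∷ v ∷ rest) ≡ L × Unique (u ∷ v ∷ rest) × Linked R (u ∷ v ∷ rest ++ [ u ])
  close e (path _ stop _ refl) (s≤s ())
  close {u} {v} e (path _ (step e′ W) uvs refl) _ with walk-last W
  ... | rest , refl = rest , xs↭ys⇒|xs|≡|ys| rotation , Unique-resp-↭ (↭-sym rotation) uvs , e ∷ walk-linked (step e′ W)
    where
      open PermutationProperties (setoid A)
      open Permutation (setoid A) using (_↭_; ↭-sym)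
      rotation : u ∷ v ∷ rest ↭ (v ∷ rest) ++ [ u ]
      rotation = ∷↭∷ʳ u (v ∷ rest)

module _ {A B : Set} {R : A → A → Set} {S : B → B → Set} where

  map-path : (f : A → B) → Injective _≡_ _≡_ f → (∀ {a b} → R a b → S (f a) (f b)) →
    ∀ {x y L} → Path R x y L → Path S (f x) (f y) L
  map-path f f-inj f-hom (path vs W u size) =
    path (map f vs) (walk-map W) (Unique.map⁺ f-inj u) (trans (length-map f vs) size)
    where
      walk-map : ∀ {x y ws} → Walk R x y ws → Walk S (f x) (f y) (map f ws)
      walk-map stop = stop
      walk-map (step e W) = step (f-hom e) (walk-map W)

HAdj : ∀ {m} → Vertex m → Vertex m → Set
HAdj {m} u v = ∃ λ (i : Fin m) → HEdge i u v

HPath : ∀ {m} → Vertex m → Vertex m → ℕ → Set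
HPath = Path HAdj

HPath⇒Path : ∀ {m} k {x y : Vertex m} {L} → HPath x y L → Path (Adj m k) x y L
HPath⇒Path k = map-path (λ v → v) (λ eq → eq) inj₁

flip-involutive : ∀ {m} (t : Fin m) (u : Vertex m) → flipBit t (flipBit t u) ≡ u
flip-involutive fzero (x ∷ u) = cong (_∷ u) (not-involutive x)
flip-involutive (fsuc t) (x ∷ u) = cong (x ∷_) (flip-involutive t u)

HAdj-sym : ∀ {m} {u v : Vertex m} → HAdj u v → HAdj v u
HAdj-sym {u = u} (t , refl) = t , sym (flip-involutive t u)

skip-zero : ∀ {m} (u : Vertex m) → skip 0 u ≡ u
skip-zero [] = refl
skip-zero (x ∷ u) = cong (x ∷_) (skip-zero u)

skip-involutive : ∀ {m} r (u : Vertex m) → skip r (skip r u) ≡ u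
skip-involutive zero u = trans (skip-zero _) (skip-zero u)
skip-involutive (suc r) [] = refl
skip-involutive (suc r) (x ∷ u) = cong₂ _∷_ (not-involutive x) (skip-involutive r u)

skip-flip : ∀ {m} r (t : Fin m) (u : Vertex m) → skip r (flipBit t u) ≡ flipBit t (skip r u)
skip-flip zero t u = trans (skip-zero _) (cong (flipBit t) (sym (skip-zero u)))
skip-flip (suc r) fzero (x ∷ u) = refl
skip-flip (suc r) (fsuc t) (x ∷ u) = cong (not x ∷_) (skip-flip r t u)

skip-flip-skip : ∀ {m} r (t : Fin m) (u : Vertex m) → skip r (flipBit t (skip r u)) ≡ flipBit t u
skip-flip-skip r t u = begin
  skip r (flipBit t (skip r u))  ≡⟨ skip-flip r t (skip r u) ⟩
  flipBit t (skip r (skip r u))  ≡⟨ cong (flipBit t) (skip-involutive r u) ⟩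
  flipBit t u                    ∎
  where open ≡-Reasoning

copy : ∀ {m} → Fin (suc m) → Bool → Vertex m → Vertex (suc m)
copy i c w = insertAt w i c

copy-injective : ∀ {m} (i : Fin (suc m)) {c c′ w w′} → copy i c w ≡ copy i c′ w′ → c ≡ c′ × w ≡ w′
copy-injective i {c} {c′} {w} {w′} eq =
  trans (sym (insertAt-lookup w i c)) (trans (cong (λ z → lookup z i) eq) (insertAt-lookup w′ i c′)) ,
  trans (sym (removeAt-insertAt w i c)) (trans (cong (λ z → removeAt z i) eq) (removeAt-insertAt w′ i c′))

copy-decompose : ∀ {m} (i : Fin (suc m)) (u : Vertex (suc m)) → copy i (lookup u i) (removeAt u i) ≡ u
copy-decompose i u = insertAt-removeAt u i

flip-copy : ∀ {m} (i : Fin (suc m)) (t : Fin m) c (w : Vertex m) →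
  flipBit (punchIn i t) (copy i c w) ≡ copy i c (flipBit t w)
flip-copy fzero t c w = refl
flip-copy (fsuc i) fzero c (x ∷ w) = refl
flip-copy (fsuc i) (fsuc t) c (x ∷ w) = cong (x ∷_) (flip-copy i t c w)

flip-copy-here : ∀ {m} (i : Fin (suc m)) c (w : Vertex m) → flipBit i (copy i c w) ≡ copy i (not c) w
flip-copy-here fzero c w = refl
flip-copy-here (fsuc i) c (x ∷ w) = cong (x ∷_) (flip-copy-here i c w)

skip-copy-low : ∀ {m} k (i : Fin (suc m)) c (w : Vertex m) → toℕ i < suc k →
  skip (suc k) (copy i c w) ≡ copy i (not c) (skip k w)
skip-copy-low k fzero c w _ = refl
skip-copy-low (suc k) (fsuc i) c (x ∷ w) (s≤s i<k) = cong (not x ∷_) (skip-copy-low k i c w i<k)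

skip-copy-high : ∀ {m} k (i : Fin (suc m)) c (w : Vertex m) → k ≤ toℕ i →
  skip k (copy i c w) ≡ copy i c (skip k w)
skip-copy-high zero i c w _ = trans (skip-zero _) (cong (copy i c) (sym (skip-zero w)))
skip-copy-high (suc k) (fsuc i) c (x ∷ w) (s≤s k≤i) = cong (not x ∷_) (skip-copy-high k i c w k≤i)

copy-HAdj : ∀ {m} (i : Fin (suc m)) c {x y : Vertex m} → HAdj x y → HAdj (copy i c x) (copy i c y)
copy-HAdj i c {x} (t , refl) = punchIn i t , sym (flip-copy i t c x)

copy-Adj : ∀ {m} k (i : Fin (suc m)) → k ≤ toℕ i → ∀ c {x y : Vertex m} → Adj m k x y → Adj (suc m) k (copy i c x) (copy i c y)
copy-Adj k i k≤i c (inj₁ e) = inj₁ (copy-HAdj i c e)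
copy-Adj k i k≤i c {x} (inj₂ refl) = inj₂ (sym (skip-copy-high k i c x k≤i))

across : ∀ {m} (i : Fin (suc m)) c (w : Vertex m) → HAdj (copy i c w) (copy i (not c) w)
across i c w = i , sym (flip-copy-here i c w)

module _ {m} (i : Fin (suc m)) {R : Vertex m → Vertex m → Set} {S : Vertex (suc m) → Vertex (suc m) → Set}
         (lift : ∀ c {x y} → R x y → S (copy i c x) (copy i c y)) where

  copy-path : ∀ c {x y L} → Path R x y L → Path S (copy i c x) (copy i c y) L
  copy-path c = map-path (copy i c) (λ eq → proj₂ (copy-injective i eq)) (lift c)

  bridge : ∀ {c₁ c₂} → c₁ ≢ c₂ → ∀ {p q r s L₁ L₂} → Path R p q L₁ → S (copy i c₁ q) (copy i c₂ r) →
    Path R r s L₂ → Path S (copy i c₁ p) (copy i c₂ s) (L₁ + L₂)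
  bridge {c₁} {c₂} c₁≢c₂ P e Q = join (copy-path c₁ P) e (copy-path c₂ Q) λ (v∈P , v∈Q) →
    let (a , _ , v≡a) = ∈-map⁻ (copy i c₁) v∈P ; (b , _ , v≡b) = ∈-map⁻ (copy i c₂) v∈Q
    in c₁≢c₂ (proj₁ (copy-injective i (trans (sym v≡a) v≡b)))

m<2^m : ∀ m → m < 2 ^ m
m<2^m zero = s≤s z≤n
m<2^m (suc m) = begin-strict
  suc m         ≤⟨ m<2^m m ⟩
  2 ^ m         <⟨ m<m+n (2 ^ m) (m^n>0 2 m) ⟩
  2 ^ m + 2 ^ m ≡⟨ cong (2 ^ m +_) (sym (+-identityʳ (2 ^ m))) ⟩
  2 ^ suc m     ∎
  where open ≤-Reasoning

1≤2^m : ∀ m → 1 ≤ 2 ^ m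
1≤2^m m = m^n>0 2 m

bitDistance : Bool → Bool → ℕ
bitDistance false false = 0
bitDistance true true = 0
bitDistance false true = 1
bitDistance true false = 1

distance : ∀ {m} → Vertex m → Vertex m → ℕ
distance [] [] = 0
distance (a ∷ x) (b ∷ y) = bitDistance a b + distance x y

distance-same : ∀ {m} a (x y : Vertex m) → distance (a ∷ x) (a ∷ y) ≡ distance x y
distance-same false x y = refl
distance-same true x y = refl

distance-not : ∀ {m} a (x y : Vertex m) → distance (a ∷ x) (not a ∷ y) ≡ suc (distance x y)
distance-not false x y = refl
distance-not true x y = refl

distance-refl : ∀ {m} (x : Vertex m) → distance x x ≡ 0
distance-refl [] = refl
distance-refl (a ∷ x) = trans (distance-same a x x) (distance-refl x)

distance≡0 : ∀ {m} (x y : Vertex m) → distance x y ≡ 0 → x ≡ y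
distance≡0 [] [] _ = refl
distance≡0 (false ∷ x) (false ∷ y) d≡0 = cong (false ∷_) (distance≡0 x y d≡0)
distance≡0 (true ∷ x) (true ∷ y) d≡0 = cong (true ∷_) (distance≡0 x y d≡0)

distance≤dim : ∀ {m} (x y : Vertex m) → distance x y ≤ m
distance≤dim [] [] = z≤n
distance≤dim (false ∷ x) (false ∷ y) = m≤n⇒m≤1+n (distance≤dim x y)
distance≤dim (true ∷ x) (true ∷ y) = m≤n⇒m≤1+n (distance≤dim x y)
distance≤dim (false ∷ x) (true ∷ y) = s≤s (distance≤dim x y)
distance≤dim (true ∷ x) (false ∷ y) = s≤s (distance≤dim x y)

distance-flip : ∀ {m} (t : Fin m) (x : Vertex m) → distance x (flipBit t x) ≡ 1
distance-flip fzero (a ∷ x) = trans (distance-not a x x) (cong suc (distance-refl x))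
distance-flip (fsuc t) (a ∷ x) = trans (distance-same a x _) (distance-flip t x)

shortest-fits : ∀ {m} (x y : Vertex m) {d} → distance x y ≡ suc d → 2 + d ≤ 2 ^ m
shortest-fits {m} x y dist = subst (λ n → suc n ≤ 2 ^ m) dist (≤-trans (s≤s (distance≤dim x y)) (m<2^m m))

closer-neighbour : ∀ {m} (x y : Vertex m) → 1 ≤ distance x y →
  Σ (Fin m) λ t → suc (distance x (flipBit t y)) ≡ distance x y
closer-neighbour [] [] ()
closer-neighbour (false ∷ x) (true ∷ y) _ = fzero , refl
closer-neighbour (true ∷ x) (false ∷ y) _ = fzero , refl
closer-neighbour (false ∷ x) (false ∷ y) d≥1 = let t , eq = closer-neighbour x y d≥1 in fsuc t , eq
closer-neighbour (true ∷ x) (true ∷ y) d≥1 = let t , eq = closer-neighbour x y d≥1 in fsuc t , eq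

farther-neighbour : ∀ {m} (x y : Vertex m) → distance x y < m →
  Σ (Fin m) λ t → distance x (flipBit t y) ≡ suc (distance x y)
farther-neighbour (false ∷ x) (false ∷ y) _ = fzero , refl
farther-neighbour (true ∷ x) (true ∷ y) _ = fzero , refl
farther-neighbour (false ∷ x) (true ∷ y) (s≤s d<m) = let t , eq = farther-neighbour x y d<m in fsuc t , cong suc eq
farther-neighbour (true ∷ x) (false ∷ y) (s≤s d<m) = let t , eq = farther-neighbour x y d<m in fsuc t , cong suc eq

distance-skip : ∀ {m} r (x : Vertex m) → r ≤ m → distance x (skip r x) ≡ r
distance-skip zero x _ = trans (cong (distance x) (skip-zero x)) (distance-refl x)
distance-skip (suc r) (a ∷ x) (s≤s r≤m) = trans (distance-not a x _) (cong suc (distance-skip r x r≤m))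

distance-skip-flip-low : ∀ {m} r (t : Fin m) (x : Vertex m) → r ≤ m → toℕ t < r →
  suc (distance x (skip r (flipBit t x))) ≡ r
distance-skip-flip-low (suc r) fzero (a ∷ x) (s≤s r≤m) _ =
  cong suc (trans (cong (λ b → bitDistance a b + distance x (skip r x)) (not-involutive a))
                  (trans (distance-same a x _) (distance-skip r x r≤m)))
distance-skip-flip-low (suc r) (fsuc t) (a ∷ x) (s≤s r≤m) (s≤s t<r) =
  cong suc (trans (distance-not a x _) (distance-skip-flip-low r t x r≤m t<r))

distance-skip-flip-high : ∀ {m} r (t : Fin m) (x : Vertex m) → r ≤ toℕ t →
  distance x (skip r (flipBit t x)) ≡ suc r
distance-skip-flip-high zero t x _ = trans (cong (distance x) (skip-zero _)) (distance-flip t x)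
distance-skip-flip-high (suc r) (fsuc t) (a ∷ x) (s≤s r≤t) =
  trans (distance-not a x _) (cong suc (distance-skip-flip-high r t x r≤t))

-- A number a + 2 + 2s of vertices that fits into two copies of capacity 2Q each
-- can be shared out as a + 2s₀ vertices in one copy and 2 + 2s₁ in the other.
share : ∀ a Q s → a ≤ 2 * Q → 1 ≤ Q → a + 2 + 2 * s ≤ 2 * (2 * Q) →
  Σ ℕ λ s₀ → Σ ℕ λ s₁ → (s ≡ s₀ + s₁) × (a + 2 * s₀ ≤ 2 * Q) × (2 + 2 * s₁ ≤ 2 * Q)
share a Q s a≤2Q _ _ with suc s ≤? Q
... | yes s<Q = 0 , s , refl , subst (_≤ 2 * Q) (sym (+-identityʳ a)) a≤2Q ,
                subst (_≤ 2 * Q) (double-suc s) (*-monoʳ-≤ 2 s<Q)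
  where double-suc : ∀ s → 2 * suc s ≡ 2 + 2 * s
        double-suc = solve-∀
share a (suc q) s _ _ bound | no s≮Q with m≤n⇒∃[o]m+o≡n (≮⇒≥ s≮Q)
... | e , refl = suc e , q , cong suc (+-comm q e) ,
                 +-cancelʳ-≤ (2 * suc q) _ _ (subst₂ _≤_ (lhs a q e) (rhs q) bound) ,
                 ≤-reflexive (rhs′ q)
  where lhs : ∀ a q e → a + 2 + 2 * (suc q + e) ≡ a + 2 * suc e + 2 * suc q
        lhs = solve-∀
        rhs : ∀ q → 2 * (2 * suc q) ≡ 2 * suc q + 2 * suc q
        rhs = solve-∀
        rhs′ : ∀ q → 2 + 2 * q ≡ 2 * suc q
        rhs′ = solve-∀

-- Q_m is bipanconnected: vertices at distance d + 1 are joined by paths with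
-- every number 2 + d + 2j ≤ 2^m of vertices (the parity is forced).
Bipanconnected : ℕ → Set
Bipanconnected m = ∀ (x y : Vertex m) d j → distance x y ≡ suc d → 2 + d + 2 * j ≤ 2 ^ m →
  HPath x y (2 + d + 2 * j)

edge-paths : ∀ {m} → Bipanconnected m → ∀ {x y : Vertex m} j → HAdj x y → 2 + 2 * j ≤ 2 ^ m → HPath x y (2 + 2 * j)
edge-paths bp {x} j (t , refl) = bp x (flipBit t x) 0 j (distance-flip t x)

lift₀ : ∀ {m} a {x y : Vertex m} {L} → HPath x y L → HPath (a ∷ x) (a ∷ y) L
lift₀ = copy-path fzero (copy-HAdj fzero)

cross₀ : ∀ {m} a {p q s : Vertex m} {L₁ L₂} → HPath p q L₁ → HPath q s L₂ → HPath (a ∷ p) (not a ∷ s) (L₁ + L₂)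
cross₀ a {q = q} P Q = bridge fzero (copy-HAdj fzero) (not-¬ refl) P (across fzero a q) Q

-- Replacing the first edge x x′ of a path in copy a by a detour
-- a∷x → ¬a∷x ⇝ ¬a∷x′ → a∷x′ through the other copy.
detour : ∀ {m} a {x y : Vertex m} {L L′} → HPath x y (suc (suc L)) →
  (∀ {x′} → HAdj x x′ → HPath x x′ L′) → HPath (a ∷ x) (a ∷ y) (suc (L′ + suc L))
detour a {x} P D with uncons P
... | x′ , x~x′ , P′ , x∉P′ = prepend (across fzero a x) detoured a∷x∉detoured
  where
    detoured = bridge fzero (copy-HAdj fzero) (λ eq → not-¬ refl (sym eq)) (D x~x′) (HAdj-sym (across fzero a x′)) P′
    a∷x∉detoured : (a ∷ x) ∉ vertices detoured
    a∷x∉detoured a∷x∈ with ∈-++⁻ (map (not a ∷_) (vertices (D x~x′))) a∷x∈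
    ... | inj₁ ∈D = let (_ , _ , eq) = ∈-map⁻ (not a ∷_) ∈D in not-¬ refl (proj₁ (copy-injective fzero eq))
    ... | inj₂ ∈P′ = let (_ , w∈P′ , eq) = ∈-map⁻ (a ∷_) ∈P′ in x∉P′ (subst (_∈ vertices P′) (sym (proj₂ (copy-injective fzero eq))) w∈P′)

-- Induction step, end points in the same copy: a path that does not fit into
-- the copy makes a detour through the other one.
same-copy : ∀ {m} → Bipanconnected m → ∀ a (x y : Vertex m) d j → distance x y ≡ suc d →
  2 + d + 2 * j ≤ 2 ^ suc m → HPath (a ∷ x) (a ∷ y) (2 + d + 2 * j)
same-copy {m} bp a x y d j dist bound with 2 + d + 2 * j ≤? 2 ^ m
... | yes fits = lift₀ a (bp x y d j dist fits)
same-copy {zero} bp a [] [] d j () bound | no _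
same-copy {suc m} bp a x y d zero dist bound | no long =
  ⊥-elim (long (subst (_≤ 2 ^ suc m) (cong (2 +_) (sym (+-identityʳ d))) (shortest-fits x y dist)))
same-copy {suc m} bp a x y d (suc s) dist bound | no _
  with share (2 + d) (2 ^ m) s (shortest-fits x y dist) (1≤2^m m)
         (subst (_≤ 2 ^ suc (suc m)) (regroup d s) bound)
  where regroup : ∀ d s → 2 + d + 2 * suc s ≡ 2 + d + 2 + 2 * s
        regroup = solve-∀
... | s₀ , s₁ , refl , fits₀ , fits₁ =
  subst (HPath (a ∷ x) (a ∷ y)) (regroup d s₀ s₁) (detour a (bp x y d s₀ dist fits₀) (λ e → edge-paths bp s₁ e fits₁))
  where regroup : ∀ d s₀ s₁ → suc (2 + 2 * s₁ + suc (d + 2 * s₀)) ≡ 2 + d + 2 * suc (s₀ + s₁)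
        regroup = solve-∀

-- Crossing between the copies next to y: a∷x ⇝ a∷z → ¬a∷z ⇝ ¬a∷y for a
-- neighbour z of y, with the vertices shared out between the two copies.
cross-near : ∀ {m} → Bipanconnected (suc m) → ∀ a (x y z : Vertex (suc m)) e s → HAdj z y →
  distance x z ≡ suc e → 2 + e + 2 + 2 * s ≤ 2 ^ suc (suc m) → HPath (a ∷ x) (not a ∷ y) (2 + e + 2 + 2 * s)
cross-near {m} bp a x y z e s z~y dist bound
  with share (2 + e) (2 ^ m) s (shortest-fits x z dist) (1≤2^m m) bound
... | s₀ , s₁ , refl , fits₀ , fits₁ =
  subst (HPath (a ∷ x) (not a ∷ y)) (regroup e s₀ s₁) (cross₀ a (bp x z e s₀ dist fits₀) (edge-paths bp s₁ z~y fits₁))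
  where regroup : ∀ e s₀ s₁ → 2 + e + 2 * s₀ + (2 + 2 * s₁) ≡ 2 + e + 2 + 2 * (s₀ + s₁)
        regroup = solve-∀

-- A path too long for one copy crosses next to y, at a neighbour z of y with
-- distance(x, z) positive and of the parity of distance(x, y) + 1.
diff-copy-long : ∀ {m} → Bipanconnected m → ∀ a (x y : Vertex m) d j → distance x y ≡ suc d →
  2 + suc d + 2 * j ≤ 2 ^ suc m → ¬ (2 + d + 2 * j ≤ 2 ^ m) → HPath (a ∷ x) (not a ∷ y) (2 + suc d + 2 * j)
diff-copy-long {zero} bp a [] [] d j () bound long
diff-copy-long {suc zero} bp a x y zero zero dist bound long = ⊥-elim (long ≤-refl)
diff-copy-long {suc zero} bp a x y zero (suc s) dist (s≤s (s≤s (s≤s (s≤s bound)))) long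
  with () ← m+n≤o⇒n≤o s bound
diff-copy-long {suc (suc m)} bp a x y zero zero dist bound long = ⊥-elim (long (*-monoʳ-≤ 2 (1≤2^m (suc m))))
diff-copy-long {suc (suc m)} bp a x y zero (suc s) dist bound long
  with farther-neighbour x y (subst (_< 2 + m) (sym dist) (s≤s (s≤s z≤n)))
... | t , farther =
  subst (HPath (a ∷ x) (not a ∷ y)) (regroup s)
    (cross-near bp a x y (flipBit t y) 1 s (HAdj-sym (t , refl)) (trans farther (cong suc dist))
      (subst (_≤ 2 ^ suc (suc (suc m))) (sym (regroup s)) bound))
  where regroup : ∀ s → 2 + 1 + 2 + 2 * s ≡ 2 + 1 + 2 * suc s
        regroup = solve-∀
diff-copy-long {suc m} bp a x y (suc d) j dist bound long
  with closer-neighbour x y (subst (1 ≤_) (sym dist) (s≤s z≤n))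
... | t , closer =
  subst (HPath (a ∷ x) (not a ∷ y)) (regroup d j)
    (cross-near bp a x y (flipBit t y) d j (HAdj-sym (t , refl)) (suc-injective (trans closer dist))
      (subst (_≤ 2 ^ suc (suc m)) (sym (regroup d j)) bound))
  where regroup : ∀ d j → 2 + d + 2 + 2 * j ≡ 2 + suc (suc d) + 2 * j
        regroup = solve-∀

diff-copy : ∀ {m} → Bipanconnected m → ∀ a (x y : Vertex m) d j → distance x y ≡ d →
  2 + d + 2 * j ≤ 2 ^ suc m → HPath (a ∷ x) (not a ∷ y) (2 + d + 2 * j)
diff-copy bp a x y zero zero dist bound with distance≡0 x y dist
... | refl = cross₀ a single single
diff-copy {zero} bp a [] [] zero (suc s) dist (s≤s (s≤s ()))
diff-copy {suc m} bp a x y zero (suc s) dist bound with distance≡0 x y dist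
... | refl = subst (HPath (a ∷ x) (not a ∷ x)) (regroup s)
               (cross-near bp a x x (flipBit fzero x) 0 s (HAdj-sym (fzero , refl)) (distance-flip fzero x)
                 (subst (_≤ 2 ^ suc (suc m)) (sym (regroup s)) bound))
  where regroup : ∀ s → 2 + 0 + 2 + 2 * s ≡ 2 + 0 + 2 * suc s
        regroup = solve-∀
diff-copy {m} bp a x y (suc d) j dist bound with 2 + d + 2 * j ≤? 2 ^ m
... | yes fits = subst (HPath (a ∷ x) (not a ∷ y)) (regroup d j) (cross₀ a (bp x y d j dist fits) single)
  where regroup : ∀ d j → 2 + d + 2 * j + 1 ≡ 2 + suc d + 2 * j
        regroup = solve-∀
... | no long = diff-copy-long bp a x y d j dist bound long

bipanconnected : ∀ m → Bipanconnected m
bipanconnected zero [] [] d j ()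
bipanconnected (suc m) (false ∷ x) (false ∷ y) = same-copy (bipanconnected m) false x y
bipanconnected (suc m) (true ∷ x) (true ∷ y) = same-copy (bipanconnected m) true x y
bipanconnected (suc m) (false ∷ x) (true ∷ y) d j dist = diff-copy (bipanconnected m) false x y d j (suc-injective dist)
bipanconnected (suc m) (true ∷ x) (false ∷ y) d j dist = diff-copy (bipanconnected m) true x y d j (suc-injective dist)

APath : ∀ m → ℕ → Vertex m → Vertex m → ℕ → Set
APath m k = Path (Adj m k)

cross-copies : ∀ {m} k (i : Fin (suc m)) {c₁ c₂} → c₁ ≢ c₂ → ∀ {p q r s : Vertex m} {L₁ L₂} →
  HPath p q L₁ → Adj (suc m) k (copy i c₁ q) (copy i c₂ r) → HPath r s L₂ →
  APath (suc m) k (copy i c₁ p) (copy i c₂ s) (L₁ + L₂)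
cross-copies k i = bridge i (λ c e → inj₁ (copy-HAdj i c e))

-- Paths across dimension i in Q_{m+1,k+1} of the shape x ⇝ w_t → flipBit t z ⇝ z,
-- with x, w_t = skip k (flipBit t x) in copy c₁ and flipBit t z, z in copy c₂,
-- given crossing edges between w_t and flipBit t z for every t.
module OddAcross {m} k (i : Fin (suc m)) {c₁ c₂} (c₁≢c₂ : c₁ ≢ c₂) (x z : Vertex m)
  (crossing : ∀ t → Adj (suc m) (suc k) (copy i c₁ (skip k (flipBit t x))) (copy i c₂ (flipBit t z))) where

  via : ∀ t {L₁} s₁ → HPath x (skip k (flipBit t x)) L₁ → 2 + 2 * s₁ ≤ 2 ^ m →
    APath (suc m) (suc k) (copy i c₁ x) (copy i c₂ z) (L₁ + (2 + 2 * s₁))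
  via t s₁ P fits = cross-copies (suc k) i c₁≢c₂ P (crossing t) (edge-paths (bipanconnected m) s₁ (HAdj-sym (t , refl)) fits)

-- Since w_t is at distance k − 1 (t < k) or k + 1 (t ≥ k) from x, these paths
-- have every odd-parity number 2 + k + 2s of vertices, for k ≥ 1.
odd-across : ∀ {m} k (i : Fin (suc m)) {c₁ c₂} → c₁ ≢ c₂ → (x z : Vertex m) →
  (∀ t → Adj (suc m) (suc k) (copy i c₁ (skip k (flipBit t x))) (copy i c₂ (flipBit t z))) →
  1 ≤ k → k ≤ m → ∀ s → 2 + k + 2 * s ≤ 2 ^ suc m → APath (suc m) (suc k) (copy i c₁ x) (copy i c₂ z) (2 + k + 2 * s)
odd-across zero i c₁≢c₂ x z crossing () k≤m s bound
odd-across {zero} (suc k) i c₁≢c₂ x z crossing 1≤k () s bound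
odd-across {suc m} 1 i c₁≢c₂ x z crossing _ k≤m zero bound =
  via fzero 0 (subst (λ w → HPath x w 1) (distance≡0 x _ w₀-at-0) single) (*-monoʳ-≤ 2 (1≤2^m m))
  where
    open OddAcross 1 i c₁≢c₂ x z crossing
    w₀-at-0 : distance x (skip 1 (flipBit fzero x)) ≡ 0
    w₀-at-0 = suc-injective (distance-skip-flip-low 1 fzero x k≤m (s≤s z≤n))
odd-across {suc zero} 1 i c₁≢c₂ x z crossing _ _ (suc s) (s≤s (s≤s (s≤s (s≤s bound))))
  with () ← m+n≤o⇒n≤o s bound
odd-across {suc (suc m)} 1 i c₁≢c₂ x z crossing _ _ (suc s) bound
  with share 3 (2 ^ suc m) s (≤-trans (n≤1+n 3) (*-monoʳ-≤ 2 (*-monoʳ-≤ 2 (1≤2^m m)))) (1≤2^m (suc m))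
         (subst (_≤ 2 ^ suc (suc (suc m))) (regroup s) bound)
  where regroup : ∀ s → 2 + 1 + 2 * suc s ≡ 3 + 2 + 2 * s
        regroup = solve-∀
... | s₀ , s₁ , refl , fits₀ , fits₁ =
  subst (APath _ 2 _ _) (regroup s₀ s₁)
    (via (fsuc fzero) s₁ (bipanconnected _ x _ 1 s₀ (distance-skip-flip-high 1 (fsuc fzero) x (s≤s z≤n)) fits₀) fits₁)
  where
    open OddAcross 1 i c₁≢c₂ x z crossing
    regroup : ∀ s₀ s₁ → 3 + 2 * s₀ + (2 + 2 * s₁) ≡ 2 + 1 + 2 * suc (s₀ + s₁)
    regroup = solve-∀
odd-across {suc m} (suc (suc k)) i c₁≢c₂ x z crossing _ k≤m s bound
  with share (2 + k) (2 ^ m) s (≤-trans k≤m (<⇒≤ (m<2^m (suc m)))) (1≤2^m m)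
         (subst (_≤ 2 ^ suc (suc m)) (regroup k s) bound)
  where regroup : ∀ k s → 2 + suc (suc k) + 2 * s ≡ 2 + k + 2 + 2 * s
        regroup = solve-∀
... | s₀ , s₁ , refl , fits₀ , fits₁ =
  subst (APath _ (suc (suc (suc k))) _ _) (regroup k s₀ s₁)
    (via fzero s₁ (bipanconnected _ x _ k s₀ w₀-at-k+1 fits₀) fits₁)
  where
    open OddAcross (suc (suc k)) i c₁≢c₂ x z crossing
    w₀-at-k+1 : distance x (skip (suc (suc k)) (flipBit fzero x)) ≡ suc k
    w₀-at-k+1 = suc-injective (distance-skip-flip-low (suc (suc k)) fzero x k≤m (s≤s z≤n))
    regroup : ∀ k s₀ s₁ → 2 + k + 2 * s₀ + (2 + 2 * s₁) ≡ 2 + suc (suc k) + 2 * (s₀ + s₁)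
    regroup = solve-∀

-- Odd paths between the ends of an edge of dimension i < k + 1: the crossing
-- edges are skips, which switch copy.
odd-low-paths : ∀ {m} k (i : Fin (suc m)) (u : Vertex m) b → toℕ i < suc k → 1 ≤ k → k ≤ m → ∀ s →
  2 + k + 2 * s ≤ 2 ^ suc m → APath (suc m) (suc k) (copy i (not b) u) (copy i b u) (2 + k + 2 * s)
odd-low-paths k i u b i<k+1 = odd-across k i (λ eq → not-¬ refl (sym eq)) u u crossing
  where
    crossing : ∀ t → Adj _ (suc k) (copy i (not b) (skip k (flipBit t u))) (copy i b (flipBit t u))
    crossing t = inj₂ (sym (begin
      skip (suc k) (copy i (not b) (skip k (flipBit t u)))  ≡⟨ skip-copy-low k i (not b) _ i<k+1 ⟩
      copy i (not (not b)) (skip k (skip k (flipBit t u)))  ≡⟨ cong₂ (copy i) (not-involutive b) (skip-involutive k _) ⟩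
      copy i b (flipBit t u)                                 ∎))
      where open ≡-Reasoning

-- Odd paths between the ends of a skip: the crossing edges have dimension 1.
odd-skip-paths : ∀ {m} k (u : Vertex m) b → 1 ≤ k → k ≤ m → ∀ s →
  2 + k + 2 * s ≤ 2 ^ suc m → APath (suc m) (suc k) (skip (suc k) (b ∷ u)) (b ∷ u) (2 + k + 2 * s)
odd-skip-paths k u b = odd-across k fzero (λ eq → not-¬ refl (sym eq)) (skip k u) u crossing
  where
    crossing : ∀ t → Adj _ (suc k) (not b ∷ skip k (flipBit t (skip k u))) (b ∷ flipBit t u)
    crossing t = inj₁ (fzero , cong₂ _∷_ (sym (not-involutive b)) (sym (skip-flip-skip k t u)))

-- Odd paths of at least k + 3 vertices between the ends of an edge of dimension
-- i ≥ k + 1: an even hypercube path in copy ¬b, the edge of dimension i, then an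
-- odd path of Q_{m,k+1} around an edge of dimension 1 inside copy b.
odd-high-paths : ∀ {m} k (i : Fin (suc m)) (u : Vertex m) b → suc k ≤ toℕ i → 1 ≤ k → suc k ≤ m → ∀ s →
  2 + k + 2 * suc s ≤ 2 ^ suc m → APath (suc m) (suc k) (copy i (not b) u) (copy i b u) (2 + k + 2 * suc s)
odd-high-paths {suc m} k i (c ∷ u) b k<i 1≤k (s≤s k≤m) s bound
  with share (2 + k) (2 ^ m) s (≤-trans (s≤s (s≤s k≤m)) (m<2^m (suc m))) (1≤2^m m)
         (subst (_≤ 2 ^ suc (suc m)) (regroup k s) bound)
  where regroup : ∀ k s → 2 + k + 2 * suc s ≡ 2 + k + 2 + 2 * s
        regroup = solve-∀
... | s₀ , s₁ , refl , fits₀ , fits₁ =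
  subst (APath _ (suc k) _ _) (regroup k s₀ s₁)
    (bridge i (copy-Adj (suc k) i k<i) (λ eq → not-¬ refl (sym eq))
      (HPath⇒Path (suc k) (edge-paths (bipanconnected (suc m)) s₁ (fzero , refl) fits₁))
      (inj₁ (HAdj-sym (across i b (not c ∷ u))))
      (odd-low-paths k fzero u c (s≤s z≤n) 1≤k k≤m s₀ fits₀))
  where regroup : ∀ k s₀ s₁ → 2 + 2 * s₁ + (2 + k + 2 * s₀) ≡ 2 + k + 2 * suc (s₀ + s₁)
        regroup = solve-∀

-- Even paths of at least 4 vertices between the ends of a skip: an even path
-- in copy ¬b, a skip, and an even path in copy b.
even-skip-paths : ∀ {m} k (u : Vertex (suc m)) b s → 4 + 2 * s ≤ 2 ^ suc (suc m) →
  APath (suc (suc m)) (suc k) (skip (suc k) (b ∷ u)) (b ∷ u) (4 + 2 * s)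
even-skip-paths {m} k u b s bound with share 2 (2 ^ m) s (*-monoʳ-≤ 2 (1≤2^m m)) (1≤2^m m) bound
... | s₀ , s₁ , refl , fits₀ , fits₁ =
  subst (APath _ (suc k) (skip (suc k) (b ∷ u)) (b ∷ u)) (regroup s₀ s₁)
    (cross-copies (suc k) fzero (λ eq → not-¬ refl (sym eq))
      (edge-paths bp s₀ (fzero , refl) fits₀)
      (inj₂ (cong₂ _∷_ (sym (not-involutive b)) (sym (skip-flip-skip k fzero u))))
      (edge-paths bp s₁ (HAdj-sym (fzero , refl)) fits₁))
  where bp = bipanconnected (suc m)
        regroup : ∀ s₀ s₁ → 2 + 2 * s₀ + (2 + 2 * s₁) ≡ 4 + 2 * (s₀ + s₁)
        regroup = solve-∀

edge-in-copies : ∀ {m} (P : Vertex (suc m) → Vertex (suc m) → Set) (i : Fin (suc m)) (u : Vertex (suc m)) →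
  (∀ w b → P (copy i (not b) w) (copy i b w)) → P (flipBit i u) u
edge-in-copies P i u along = subst₂ P flipped (copy-decompose i u) (along (removeAt u i) (lookup u i))
  where
    flipped : copy i (not (lookup u i)) (removeAt u i) ≡ flipBit i u
    flipped = trans (sym (flip-copy-here i (lookup u i) (removeAt u i))) (cong (flipBit i) (copy-decompose i u))

even-cycles : ∀ m k (u v : Vertex (suc (suc m))) → Adj _ (suc k) u v → ∀ j →
  4 + 2 * j ≤ 2 ^ suc (suc m) → OnCycle _ (suc k) (4 + 2 * j) u v
even-cycles m k u _ u~v@(inj₁ (i , refl)) j bound =
  close u~v (subst (APath _ (suc k) (flipBit i u) u) (regroup j) (HPath⇒Path (suc k) back)) (s≤s (s≤s z≤n))
  where regroup : ∀ j → 2 + 2 * suc j ≡ 4 + 2 * j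
        regroup = solve-∀
        back : HPath (flipBit i u) u (2 + 2 * suc j)
        back = edge-paths (bipanconnected _) (suc j) (HAdj-sym (i , refl)) (subst (_≤ 2 ^ suc (suc m)) (sym (regroup j)) bound)
even-cycles m k (b ∷ u) _ u~v@(inj₂ refl) j bound = close u~v (even-skip-paths k u b j bound) (s≤s (s≤s z≤n))

odd-cycles : ∀ m k (u v : Vertex (suc m)) → Adj _ (suc k) u v → 1 ≤ k → k ≤ m → ∀ s →
  2 + k + 2 * s ≤ 2 ^ suc m → (s ≡ 0 → ¬ (Σ (Fin (suc m)) λ i → (suc k ≤ toℕ i) × HEdge i u v)) →
  OnCycle _ (suc k) (2 + k + 2 * s) u v
odd-cycles m k (b ∷ u) _ u~v@(inj₂ refl) 1≤k k≤m s bound _ =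
  close u~v (odd-skip-paths k u b 1≤k k≤m s bound) (s≤s (s≤s z≤n))
odd-cycles m k u _ u~v@(inj₁ (i , refl)) 1≤k k≤m s bound not-high with suc k ≤? toℕ i
... | no low =
  close u~v (edge-in-copies (λ x y → APath _ (suc k) x y _) i u λ w b →
               odd-low-paths k i w b (≰⇒> low) 1≤k k≤m s bound)
        (s≤s (s≤s z≤n))
odd-cycles m k u _ (inj₁ (i , refl)) _ _ zero _ not-high | yes high = ⊥-elim (not-high refl (i , high , refl))
odd-cycles m k u _ u~v@(inj₁ (i , refl)) 1≤k k≤m (suc s) bound _ | yes high =
  close u~v (edge-in-copies (λ x y → APath _ (suc k) x y _) i u λ w b →
               odd-high-paths k i w b high 1≤k (≤-trans high (s≤s⁻¹ (toℕ<n i))) s bound)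
        (s≤s (s≤s z≤n))

parity : ∀ n → (∃ λ s → n ≡ 2 * s) ⊎ (∃ λ s → n ≡ suc (2 * s))
parity zero = inj₁ (0 , refl)
parity (suc n) with parity n
... | inj₁ (s , refl) = inj₂ (s , refl)
... | inj₂ (s , refl) = inj₁ (suc s , double-suc s)
  where double-suc : ∀ s → 2 + 2 * s ≡ 2 * suc s
        double-suc = solve-∀

even-form : ∀ ℓ → 4 ≤ ℓ → 2 ∣ ℓ → ∃ λ j → ℓ ≡ 4 + 2 * j
even-form _ (s≤s (s≤s (s≤s (s≤s _)))) (divides (suc (suc j)) refl) = j , regroup j
  where regroup : ∀ j → suc (suc j) * 2 ≡ 4 + 2 * j
        regroup = solve-∀

odd-form : ∀ k ℓ → 2 ∣ suc k → ¬ (2 ∣ ℓ) → 2 + k ≤ ℓ → ∃ λ s → ℓ ≡ 2 + k + 2 * s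
odd-form k ℓ 2∣k+1 2∤ℓ k+2≤ℓ with m≤n⇒∃[o]m+o≡n k+2≤ℓ
... | e , refl with parity e
... | inj₁ (s , refl) = s , refl
... | inj₂ (s , refl) = ⊥-elim (2∤ℓ (subst (2 ∣_) (regroup k s) (∣m∣n⇒∣m+n 2∣k+1 (m∣m*n (suc s)))))
  where regroup : ∀ k s → suc k + 2 * suc s ≡ 2 + k + suc (2 * s)
        regroup = solve-∀

theorem1 : (n k : ℕ) → 3 ≤ n → 1 ≤ k → k ≤ n →
    (u v : Vertex n) → Adj n k u v →
    ((ℓ : ℕ) → 4 ≤ ℓ → ℓ ≤ 2 ^ n → 2 ∣ ℓ → OnCycle n k ℓ u v)
    × (2 ∣ k →
        ((ℓ : ℕ) → k + 3 ≤ ℓ → ℓ ≤ 2 ^ n ∸ 1 → ¬ (2 ∣ ℓ) → OnCycle n k ℓ u v)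
        × (¬ (Σ (Fin n) λ i → (k ≤ toℕ i) × HEdge i u v) → OnCycle n k (k + 1) u v))
theorem1 (suc (suc m)) (suc k) (s≤s (s≤s _)) _ k+1≤n u v u~v = even , λ 2∣k+1 → odd 2∣k+1 , short 2∣k+1
  where
    n = suc (suc m)
    k≤m+1 = s≤s⁻¹ k+1≤n
    cycle : ∀ {ℓ ℓ′} → ℓ′ ≡ ℓ → OnCycle n (suc k) ℓ′ u v → OnCycle n (suc k) ℓ u v
    cycle = subst (λ ℓ → OnCycle n (suc k) ℓ u v)

    even : ∀ ℓ → 4 ≤ ℓ → ℓ ≤ 2 ^ n → 2 ∣ ℓ → OnCycle n (suc k) ℓ u v
    even ℓ 4≤ℓ ℓ≤2ⁿ 2∣ℓ with even-form ℓ 4≤ℓ 2∣ℓ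
    ... | j , refl = even-cycles m k u v u~v j ℓ≤2ⁿ

    odd : 2 ∣ suc k → ∀ ℓ → suc k + 3 ≤ ℓ → ℓ ≤ 2 ^ n ∸ 1 → ¬ (2 ∣ ℓ) → OnCycle n (suc k) ℓ u v
    odd 2∣k+1 ℓ k+4≤ℓ ℓ<2ⁿ 2∤ℓ
      with odd-form (suc (suc k)) ℓ (∣m∣n⇒∣m+n (m∣m*n 1) 2∣k+1) 2∤ℓ (subst (_≤ ℓ) (+-comm (suc k) 3) k+4≤ℓ)
    ... | s , refl = cycle (sym (regroup k s))
          (odd-cycles (suc m) k u v u~v (s≤s⁻¹ (∣⇒≤ 2∣k+1)) k≤m+1 (suc s)
            (subst (_≤ 2 ^ n) (regroup k s) (≤-trans ℓ<2ⁿ (m∸n≤m _ 1))) λ ())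
      where regroup : ∀ k s → 4 + k + 2 * s ≡ 2 + k + 2 * suc s
            regroup = solve-∀

    short : 2 ∣ suc k → ¬ (Σ (Fin n) λ i → (suc k ≤ toℕ i) × HEdge i u v) → OnCycle n (suc k) (suc k + 1) u v
    short 2∣k+1 not-high = cycle (regroup k)
      (odd-cycles (suc m) k u v u~v (s≤s⁻¹ (∣⇒≤ 2∣k+1)) k≤m+1 0
        (subst (_≤ 2 ^ n) (sym (+-identityʳ (2 + k))) (≤-trans (s≤s k+1≤n) (m<2^m n))) (λ _ → not-high))
      where regroup : ∀ k → 2 + k + 2 * 0 ≡ suc k + 1
            regroup = solve-∀
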